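{- For every integer $n\ge 0$, $$[\mathrm{CW}(n)]_q = q\,\mathrm{CW}_q(n).$$
   Context: A hyperbinary partition of an integer $n\ge 0$ is a partition of $n$ in which every part is a power of $2$ and each part occurs at most twice. Let $H(n)$ be the set of hyperbinary partitions of $n$ (with $H(0)=\{\text{empty partition}\}$, $H(-1)=\emptyset$), and let $h_q(n)=\sum_{\eta\in H(n)} q^{\ell(\eta)}$, where $\ell(\eta)$ is the number of parts of $\eta$ (so $h_q(-1)=0$, $h_q(0)=1$). Stern's diatomic sequence is defined by $\mathrm{fusc}(0)=0$, $\mathrm{fusc}(1)=1$, and for $n\ge1$: $\mathrm{fusc}(2n)=\mathrm{fusc}(n)$, $\mathrm{fusc}(2n+1)=\mathrm{fusc}(n)+\mathrm{fusc}(n+1)$. The Calkin–Wilf sequence is $\mathrm{CW}(n)=\mathrm{fusc}(n)/\mathrm{fusc}(n+1)$ for $n\ge0$. The $q$-Calkin–Wilf sequence is $\mathrm{CW}_q(0)=0$ and $\mathrm{CW}_q(n)=h_q(n-1)/h_q(n)$ for $n\ge1$. $q$-deformed rationals (Morier-Genoud–Ovsienko): $[0]_q=0$. For a positive rational $x$, write a continued fraction $x=a_1+\cfrac{1}{a_2+\cfrac{1}{\ddots+\cfrac{1}{a_m}}}$ with $a_1\ge0$ and $a_2,\dots,a_m\ge1$ integers. Then $[x]_q$ is the rational function obtained by replacing each $a_i$ by $[a_i]_q=1+q+\dots+q^{a_i-1}$ if $i$ is odd and by $[a_i]_{q^{ -1}}$ if $i$ is even, and replacing the numerator $1$ of the fraction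 that follows $a_i$ by $q^{a_i}$ if $i$ is odd and by $q^{ -a_i}$ if $i$ is even; i.e. $[x]_q=[a_1]_q+\cfrac{q^{a_1}}{[a_2]_{q^{ -1}}+\cfrac{q^{ -a_2}}{\ddots}}$. This does not depend on the choice of continued fraction expansion. -}

module Defs where

open import Data.Nat as ℕ using (ℕ; zero; suc; _+_; _*_; _^_; _≡ᵇ_)
open import Data.Nat.DivMod using (_/_; _%_)
open import Data.Integer as ℤ using (ℤ; 0ℤ; 1ℤ)
open import Data.List using (List; []; _∷_; map; replicate; concat; concatMap; filter; length; foldr)
open import Data.Bool using (Bool; true; false; not; if_then_else_)
open import Data.Product using (∃; _×_)
open import Relation.Binary.PropositionalEquality using (_≡_; _≢_)

-- Polynomials in q with integer coefficients (ascending coefficient lists)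

Poly : Set
Poly = List ℤ

coeff : Poly → ℕ → ℤ
coeff [] _ = 0ℤ
coeff (c ∷ p) zero = c
coeff (c ∷ p) (suc i) = coeff p i

_⊕_ : Poly → Poly → Poly
[] ⊕ p = p
(a ∷ p) ⊕ [] = a ∷ p
(a ∷ p) ⊕ (b ∷ r) = (a ℤ.+ b) ∷ (p ⊕ r)

scale : ℤ → Poly → Poly
scale c = map (c ℤ.*_)

_⊗_ : Poly → Poly → Poly
[] ⊗ r = []
(a ∷ p) ⊗ r = scale a r ⊕ (0ℤ ∷ (p ⊗ r))

_≈ₚ_ : Poly → Poly → Set
p ≈ₚ r = ∀ i → coeff p i ≡ coeff r i

NonZeroPoly : Poly → Set
NonZeroPoly p = ∃ λ i → coeff p i ≢ 0ℤ

qpow : ℕ → Poly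
qpow zero = 1ℤ ∷ []
qpow (suc k) = 0ℤ ∷ qpow k

qint : ℕ → Poly
qint a = replicate a 1ℤ

record RatFun : Set where
  constructor _//_
  field
    num : Poly
    den : Poly
open RatFun public

0ᵣ : RatFun
0ᵣ = [] // (1ℤ ∷ [])

_+ᵣ_ : RatFun → RatFun → RatFun
(a // b) +ᵣ (c // d) = ((a ⊗ d) ⊕ (c ⊗ b)) // (b ⊗ d)

_÷ᵣ_ : RatFun → RatFun → RatFun
(a // b) ÷ᵣ (c // d) = (a ⊗ d) // (b ⊗ c)

_≈ᵣ_ : RatFun → RatFun → Set
(a // b) ≈ᵣ (c // d) = (a ⊗ d) ≈ₚ (c ⊗ b)

-- q-deformed continued fractions (Morier-Genoud–Ovsienko)
-- Bool flag: true = odd position (use q), false = even position (use q⁻¹)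

-- [a]_q  resp.  [a]_{q⁻¹} = q·[a]_q / q^a
qintᵇ : Bool → ℕ → RatFun
qintᵇ true  a = qint a // (1ℤ ∷ [])
qintᵇ false a = (0ℤ ∷ qint a) // qpow a

qpowᵇ : Bool → ℕ → RatFun
qpowᵇ true  a = qpow a // (1ℤ ∷ [])
qpowᵇ false a = (1ℤ ∷ []) // qpow a

cfq : Bool → List ℕ → RatFun
cfq b [] = 0ᵣ
cfq b (a ∷ []) = qintᵇ b a
cfq b (a ∷ a' ∷ as) = qintᵇ b a +ᵣ (qpowᵇ b a ÷ᵣ cfq (not b) (a' ∷ as))

-- continued fraction expansion of a / b via the Euclidean algorithm
-- (fuel argument; suc b steps always suffice)
cfExp : ℕ → ℕ → ℕ → List ℕ
cfExp zero _ _ = []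
cfExp (suc f) a zero = []
cfExp (suc f) a (suc b) = (a / suc b) ∷ cfExp f (suc b) (a % suc b)

cfOf : ℕ → ℕ → List ℕ
cfOf a b = cfExp (suc b) a b

-- [a / b]_q for a ≥ 0, b > 0  (gives [0]_q = 0 for a = 0)
qRatOf : ℕ → ℕ → RatFun
qRatOf a b = cfq true (cfOf a b)

-- Stern's diatomic sequence (fuel-based; fuel n suffices for argument n)

fuscF : ℕ → ℕ → ℕ
fuscF zero _ = 0
fuscF (suc f) zero = 0
fuscF (suc f) (suc zero) = 1
fuscF (suc f) (suc (suc m)) =
  if (m % 2) ≡ᵇ 0
  then fuscF f (suc (m / 2))                               -- fusc(2k+2) = fusc(k+1)
  else fuscF f (suc (m / 2)) + fuscF f (suc (suc (m / 2)))  -- fusc(2k+3) = fusc(k+1)+fusc(k+2)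

fusc : ℕ → ℕ
fusc n = fuscF n n

qCW : ℕ → RatFun
qCW n = qRatOf (fusc n) (fusc (suc n))

-- A partition into powers of 2, each part occurring at most twice, is
-- determined by its multiplicity vector (d₀, d₁, …) with dᵢ ∈ {0,1,2}
-- the multiplicity of the part 2^i.  For a partition of n only parts
-- 2^i with i ≤ n can occur, so vectors of length n+1 suffice.

multVecs : ℕ → List (List ℕ)
multVecs zero = [] ∷ []
multVecs (suc k) = concatMap (λ v → (0 ∷ v) ∷ (1 ∷ v) ∷ (2 ∷ v) ∷ []) (multVecs k)

partsFrom : ℕ → List ℕ → List ℕ
partsFrom i [] = []
partsFrom i (d ∷ ds) = replicate d (2 ^ i) Data.List.++ partsFrom (suc i) ds

toPartition : List ℕ → List ℕ
toPartition = partsFrom 0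

sumL : List ℕ → ℕ
sumL = foldr _+_ 0

H : ℕ → List (List ℕ)
H n = filter (λ η → sumL η ℕ.≟ n) (map toPartition (multVecs (suc n)))

hq : ℕ → Poly
hq n = foldr (λ η acc → qpow (length η) ⊕ acc) [] (H n)

CWq : ℕ → RatFun
CWq zero = 0ᵣ
CWq (suc m) = hq m // hq (suc m)

qTimes : RatFun → RatFun
qTimes (a // b) = (0ℤ ∷ a) // b

-- Both sides obey the q-deformed Calkin–Wilf recursion.  The children of x in the Calkin–Wilf
-- tree are 1 + x (n ↦ 2n + 1) and x / (1 + x) (n ↦ 2n), and for q-rationals
-- [1 + x]_q = 1 + q [x]_q and [x / (1 + x)]_q = q [x]_q / (1 + q [x]_q), read off from the
-- continued fractions (x / (1 + x) = 1 / (1 + 1 / x)).  On the other side, sorting hyperbinary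
-- partitions by their number of parts equal to 1 gives h(2k + 1) = q h(k) and
-- h(2k + 2) = h(k + 1) + q² h(k), which make q h(n − 1) / h(n) follow the same two rules.
-- Everything is carried out on unreduced fractions of polynomials: the invariant
-- N · h(n) = q h(n − 1) · D is stated cross-multiplied, so no cancellation in ℤ[q] is needed,
-- and the stray common powers of q produced by the continued fractions do not affect it.
-- At q = 1 the numerators and denominators become Stern's fusc n and fusc (n + 1), which shows
-- that the denominators are nonzero.

module Submission where

open import Defs
open import Data.Bool using (true; false; if_then_else_)
open import Data.Integer as ℤ using (ℤ; 0ℤ; 1ℤ) renaming (_+_ to _+ℤ_; _*_ to _*ℤ_)
import Data.Integer.Properties as ℤₚ
open import Data.Integer.Tactic.RingSolver as ℤ-Solver using ()
open import Data.List using (List; []; _∷_; _++_; length; replicate; filter; map; foldr; concatMap)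
import Data.List.Properties as Listₚ
open import Data.Maybe using (nothing)
open import Data.Nat as ℕ using (ℕ; zero; suc; _+_; _*_; _^_; _≤_; _<_; s≤s; z≤n; _≡ᵇ_)
open import Data.Nat.DivMod
open import Data.Nat.Divisibility using (m∣m*n)
open import Data.Nat.Induction using (<-rec)
open import Data.Nat.ListAction.Properties using (sum-++)
import Data.Nat.Properties as ℕₚ
open import Data.Nat.Tactic.RingSolver as ℕ-Solver using ()
open import Data.Product using (_×_; _,_; proj₂; ∃-syntax)
open import Function using (_∘_)
open import Relation.Binary.Bundles using (Setoid)
open import Relation.Binary.Definitions using (tri<; tri≈; tri>)
open import Relation.Binary.PropositionalEquality
import Relation.Binary.Reasoning.Setoid as SetoidReasoning
open import Relation.Binary.Structures using (IsEquivalence)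
open import Relation.Nullary using (yes; no; does; contradiction)
open import Relation.Nullary.Decidable using (dec-true; dec-false)
open import Algebra.Bundles using (CommutativeSemiring; CommutativeMonoid)
open import Algebra.Structures using (IsCommutativeMonoid)
import Algebra.Properties.CommutativeSemigroup as CommSemigroupProperties
import Tactic.RingSolver as RingSolver
import Tactic.RingSolver.Core.AlmostCommutativeRing as ACR

-- Polynomials over ℤ

infix 4 _≋_

-- A record rather than the bare function type _≈ₚ_, so that both polynomials can be
-- inferred from a proof.
record _≋_ (p r : Poly) : Set where
  constructor mk≋
  field coeff-≡ : p ≈ₚ r
open _≋_ public

≋-isEquivalence : IsEquivalence _≋_
≋-isEquivalence = record
  { refl  = mk≋ λ _ → refl
  ; sym   = λ (mk≋ e) → mk≋ λ i → sym (e i)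
  ; trans = λ (mk≋ e) (mk≋ f) → mk≋ λ i → trans (e i) (f i)
  }

open IsEquivalence ≋-isEquivalence public
  using () renaming (refl to ≋-refl; sym to ≋-sym; trans to ≋-trans; reflexive to ≋-reflexive)

≋-setoid : Setoid _ _
≋-setoid = record { isEquivalence = ≋-isEquivalence }

∷-cong : ∀ {a b p r} → a ≡ b → p ≋ r → (a ∷ p) ≋ (b ∷ r)
∷-cong a≡b (mk≋ e) = mk≋ λ { zero → a≡b ; (suc i) → e i }

coeff-⊕ : ∀ p r i → coeff (p ⊕ r) i ≡ coeff p i +ℤ coeff r i
coeff-⊕ []      r       i       = sym (ℤₚ.+-identityˡ _)
coeff-⊕ (a ∷ p) []      i       = sym (ℤₚ.+-identityʳ _)
coeff-⊕ (a ∷ p) (b ∷ r) zero    = refl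
coeff-⊕ (a ∷ p) (b ∷ r) (suc i) = coeff-⊕ p r i

coeff-scale : ∀ c p i → coeff (scale c p) i ≡ c *ℤ coeff p i
coeff-scale c []      i       = sym (ℤₚ.*-zeroʳ c)
coeff-scale c (a ∷ p) zero    = refl
coeff-scale c (a ∷ p) (suc i) = coeff-scale c p i

⊕-cong : ∀ {p p′ r r′} → p ≋ p′ → r ≋ r′ → p ⊕ r ≋ p′ ⊕ r′
⊕-cong {p} {p′} {r} {r′} (mk≋ e) (mk≋ f) = mk≋ λ i →
  trans (coeff-⊕ p r i) (trans (cong₂ _+ℤ_ (e i) (f i)) (sym (coeff-⊕ p′ r′ i)))

⊕-comm : ∀ p r → p ⊕ r ≋ r ⊕ p
⊕-comm p r = mk≋ λ i →
  trans (coeff-⊕ p r i) (trans (ℤₚ.+-comm (coeff p i) _) (sym (coeff-⊕ r p i)))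

⊕-assoc : ∀ p r s → (p ⊕ r) ⊕ s ≋ p ⊕ (r ⊕ s)
⊕-assoc p r s = mk≋ λ i → begin
  coeff ((p ⊕ r) ⊕ s) i                 ≡⟨ coeff-⊕ (p ⊕ r) s i ⟩
  coeff (p ⊕ r) i +ℤ coeff s i          ≡⟨ cong (_+ℤ coeff s i) (coeff-⊕ p r i) ⟩
  coeff p i +ℤ coeff r i +ℤ coeff s i  ≡⟨ ℤₚ.+-assoc (coeff p i) _ _ ⟩
  coeff p i +ℤ (coeff r i +ℤ coeff s i) ≡⟨ cong (coeff p i +ℤ_) (coeff-⊕ r s i) ⟨
  coeff p i +ℤ coeff (r ⊕ s) i          ≡⟨ coeff-⊕ p (r ⊕ s) i ⟨
  coeff (p ⊕ (r ⊕ s)) i                 ∎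
  where open ≡-Reasoning

⊕-identityʳ : ∀ p → p ⊕ [] ≋ p
⊕-identityʳ p = mk≋ λ i → trans (coeff-⊕ p [] i) (ℤₚ.+-identityʳ _)

0∷[]≋[] : 0ℤ ∷ [] ≋ []
0∷[]≋[] = mk≋ λ { zero → refl ; (suc i) → refl }

⊕-isCommutativeMonoid : IsCommutativeMonoid _≋_ _⊕_ []
⊕-isCommutativeMonoid = record
  { isMonoid = record
    { isSemigroup = record
      { isMagma = record { isEquivalence = ≋-isEquivalence ; ∙-cong = ⊕-cong }
      ; assoc = ⊕-assoc }
    ; identity = (λ _ → ≋-refl) , ⊕-identityʳ }
  ; comm = ⊕-comm }

⊕-commutativeMonoid : CommutativeMonoid _ _
⊕-commutativeMonoid = record { isCommutativeMonoid = ⊕-isCommutativeMonoid }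

open CommSemigroupProperties (CommutativeMonoid.commutativeSemigroup ⊕-commutativeMonoid)
  using () renaming (interchange to ⊕-interchange; x∙yz≈y∙xz to ⊕-leftComm)

scale-cong : ∀ c {p r} → p ≋ r → scale c p ≋ scale c r
scale-cong c {p} {r} (mk≋ e) = mk≋ λ i →
  trans (coeff-scale c p i) (trans (cong (c *ℤ_) (e i)) (sym (coeff-scale c r i)))

scale-⊕ : ∀ c p r → scale c (p ⊕ r) ≋ scale c p ⊕ scale c r
scale-⊕ c p r = mk≋ λ i → begin
  coeff (scale c (p ⊕ r)) i                   ≡⟨ coeff-scale c (p ⊕ r) i ⟩
  c *ℤ coeff (p ⊕ r) i                        ≡⟨ cong (c *ℤ_) (coeff-⊕ p r i) ⟩
  c *ℤ (coeff p i +ℤ coeff r i)               ≡⟨ ℤₚ.*-distribˡ-+ c (coeff p i) _ ⟩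
  c *ℤ coeff p i +ℤ c *ℤ coeff r i            ≡⟨ cong₂ _+ℤ_ (coeff-scale c p i) (coeff-scale c r i) ⟨
  coeff (scale c p) i +ℤ coeff (scale c r) i  ≡⟨ coeff-⊕ (scale c p) (scale c r) i ⟨
  coeff (scale c p ⊕ scale c r) i             ∎
  where open ≡-Reasoning

scale-scale : ∀ a b p → scale a (scale b p) ≋ scale (a *ℤ b) p
scale-scale a b p = mk≋ λ i → begin
  coeff (scale a (scale b p)) i  ≡⟨ coeff-scale a (scale b p) i ⟩
  a *ℤ coeff (scale b p) i       ≡⟨ cong (a *ℤ_) (coeff-scale b p i) ⟩
  a *ℤ (b *ℤ coeff p i)          ≡⟨ ℤₚ.*-assoc a b (coeff p i) ⟨
  a *ℤ b *ℤ coeff p i            ≡⟨ coeff-scale (a *ℤ b) p i ⟨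
  coeff (scale (a *ℤ b) p) i     ∎
  where open ≡-Reasoning

scale-zero : ∀ p → scale 0ℤ p ≋ []
scale-zero p = mk≋ λ i → trans (coeff-scale 0ℤ p i) (ℤₚ.*-zeroˡ (coeff p i))

scale-one : ∀ p → scale 1ℤ p ≋ p
scale-one p = mk≋ λ i → trans (coeff-scale 1ℤ p i) (ℤₚ.*-identityˡ (coeff p i))

⊗-zeroʳ : ∀ p → p ⊗ [] ≋ []
⊗-zeroʳ []      = ≋-refl
⊗-zeroʳ (a ∷ p) = ≋-trans (∷-cong refl (⊗-zeroʳ p)) 0∷[]≋[]

⊗-congʳ : ∀ p {r r′} → r ≋ r′ → p ⊗ r ≋ p ⊗ r′
⊗-congʳ []      r≋r′ = ≋-refl
⊗-congʳ (a ∷ p) r≋r′ = ⊕-cong (scale-cong a r≋r′) (∷-cong refl (⊗-congʳ p r≋r′))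

⊗-∷ʳ : ∀ p b r → p ⊗ (b ∷ r) ≋ scale b p ⊕ (0ℤ ∷ p ⊗ r)
⊗-∷ʳ []      b r = ≋-sym 0∷[]≋[]
⊗-∷ʳ (a ∷ p) b r = ∷-cong (cong (_+ℤ 0ℤ) (ℤₚ.*-comm a b)) (begin
  scale a r ⊕ (p ⊗ (b ∷ r))               ≈⟨ ⊕-cong ≋-refl (⊗-∷ʳ p b r) ⟩
  scale a r ⊕ (scale b p ⊕ (0ℤ ∷ p ⊗ r))  ≈⟨ ⊕-leftComm (scale a r) (scale b p) _ ⟩
  scale b p ⊕ (scale a r ⊕ (0ℤ ∷ p ⊗ r))  ∎)
  where open SetoidReasoning ≋-setoid

⊗-comm : ∀ p r → p ⊗ r ≋ r ⊗ p
⊗-comm []      r = ≋-sym (⊗-zeroʳ r)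
⊗-comm (a ∷ p) r = ≋-trans (⊕-cong ≋-refl (∷-cong refl (⊗-comm p r))) (≋-sym (⊗-∷ʳ r a p))

⊗-congˡ : ∀ {p p′} r → p ≋ p′ → p ⊗ r ≋ p′ ⊗ r
⊗-congˡ {p} {p′} r p≋p′ = ≋-trans (⊗-comm p r) (≋-trans (⊗-congʳ r p≋p′) (⊗-comm r p′))

⊗-cong : ∀ {p p′ r r′} → p ≋ p′ → r ≋ r′ → p ⊗ r ≋ p′ ⊗ r′
⊗-cong {p′ = p′} {r = r} p≋p′ r≋r′ = ≋-trans (⊗-congˡ r p≋p′) (⊗-congʳ p′ r≋r′)

⊗-distribˡ : ∀ p r s → p ⊗ (r ⊕ s) ≋ (p ⊗ r) ⊕ (p ⊗ s)
⊗-distribˡ []      r s = ≋-refl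
⊗-distribˡ (a ∷ p) r s = ≋-trans
  (⊕-cong (scale-⊕ a r s) (∷-cong (sym (ℤₚ.+-identityʳ 0ℤ)) (⊗-distribˡ p r s)))
  (⊕-interchange (scale a r) (scale a s) (0ℤ ∷ p ⊗ r) (0ℤ ∷ p ⊗ s))

⊗-distribʳ : ∀ p r s → (r ⊕ s) ⊗ p ≋ (r ⊗ p) ⊕ (s ⊗ p)
⊗-distribʳ p r s = ≋-trans (⊗-comm (r ⊕ s) p)
  (≋-trans (⊗-distribˡ p r s) (⊕-cong (⊗-comm p r) (⊗-comm p s)))

scale-⊗ : ∀ a r s → (scale a r) ⊗ s ≋ scale a (r ⊗ s)
scale-⊗ a []      s = ≋-refl
scale-⊗ a (b ∷ r) s = ≋-trans
  (⊕-cong (≋-sym (scale-scale a b s)) (∷-cong (sym (ℤₚ.*-zeroʳ a)) (scale-⊗ a r s)))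
  (≋-sym (scale-⊕ a (scale b s) (0ℤ ∷ r ⊗ s)))

⊗-assoc : ∀ p r s → (p ⊗ r) ⊗ s ≋ p ⊗ (r ⊗ s)
⊗-assoc []      r s = ≋-refl
⊗-assoc (a ∷ p) r s = begin
  (scale a r ⊕ (0ℤ ∷ p ⊗ r)) ⊗ s          ≈⟨ ⊗-distribʳ s (scale a r) _ ⟩
  (scale a r ⊗ s) ⊕ ((0ℤ ∷ p ⊗ r) ⊗ s)    ≈⟨ ⊕-cong (scale-⊗ a r s) (⊕-cong (scale-zero s) ≋-refl) ⟩
  scale a (r ⊗ s) ⊕ (0ℤ ∷ ((p ⊗ r) ⊗ s))  ≈⟨ ⊕-cong ≋-refl (∷-cong refl (⊗-assoc p r s)) ⟩
  scale a (r ⊗ s) ⊕ (0ℤ ∷ p ⊗ (r ⊗ s))    ∎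
  where open SetoidReasoning ≋-setoid

one : Poly
one = 1ℤ ∷ []

⊗-identityˡ : ∀ p → one ⊗ p ≋ p
⊗-identityˡ p = ≋-trans (⊕-cong (scale-one p) 0∷[]≋[]) (⊕-identityʳ p)

⊗-identityʳ : ∀ p → p ⊗ one ≋ p
⊗-identityʳ p = ≋-trans (⊗-comm p one) (⊗-identityˡ p)

polySemiring : CommutativeSemiring _ _
polySemiring = record
  { isCommutativeSemiring = record
    { isSemiring = record
      { isSemiringWithoutAnnihilatingZero = record
        { +-isCommutativeMonoid = ⊕-isCommutativeMonoid
        ; *-cong = ⊗-cong
        ; *-assoc = ⊗-assoc
        ; *-identity = ⊗-identityˡ , ⊗-identityʳ
        ; distrib = ⊗-distribˡ , ⊗-distribʳ }
      ; zero = (λ _ → ≋-refl) , ⊗-zeroʳ }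
    ; *-comm = ⊗-comm } }

open CommSemigroupProperties (CommutativeSemiring.*-commutativeSemigroup polySemiring)
  using () renaming (x∙yz≈y∙xz to ⊗-leftComm)

polyRing : ACR.AlmostCommutativeRing _ _
polyRing = ACR.fromCommutativeSemiring polySemiring (λ _ → nothing)

q : Poly
q = qpow 1

0∷≋q⊗ : ∀ p → 0ℤ ∷ p ≋ q ⊗ p
0∷≋q⊗ p = ≋-sym (⊕-cong (scale-zero p) (∷-cong refl (⊗-identityˡ p)))

qpow-suc : ∀ a → qpow (suc a) ≋ q ⊗ qpow a
qpow-suc a = 0∷≋q⊗ (qpow a)

qpow-+ : ∀ a b → qpow (a ℕ.+ b) ≋ qpow a ⊗ qpow b
qpow-+ zero    b = ≋-sym (⊗-identityˡ (qpow b))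
qpow-+ (suc a) b = ≋-sym (⊕-cong (scale-zero (qpow b)) (∷-cong refl (≋-sym (qpow-+ a b))))

qint-suc : ∀ a → qint (suc a) ≋ one ⊕ (q ⊗ qint a)
qint-suc a = ≋-trans (∷-cong (sym (ℤₚ.+-identityʳ 1ℤ)) ≋-refl) (⊕-cong {one} ≋-refl (0∷≋q⊗ (qint a)))

qint-sucʳ : ∀ a → qint (suc a) ≋ qint a ⊕ qpow a
qint-sucʳ zero    = ≋-refl
qint-sucʳ (suc a) = ∷-cong refl (qint-sucʳ a)

0∷qint-suc : ∀ a → 0ℤ ∷ qint (suc a) ≋ q ⊗ (qint a ⊕ qpow a)
0∷qint-suc a = ≋-trans (0∷≋q⊗ (qint (suc a))) (⊗-congʳ q (qint-sucʳ a))

eval₁ : Poly → ℤ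
eval₁ []      = 0ℤ
eval₁ (c ∷ p) = c +ℤ eval₁ p

eval₁-cong : ∀ {p r} → p ≋ r → eval₁ p ≡ eval₁ r
eval₁-cong {p} {r} (mk≋ e) = go p r e
  where
  go : ∀ p r → p ≈ₚ r → eval₁ p ≡ eval₁ r
  go []      []      e = refl
  go []      (b ∷ r) e = cong₂ _+ℤ_ (e zero) (go [] r (e ∘ suc))
  go (a ∷ p) []      e = cong₂ _+ℤ_ (e zero) (go p [] (e ∘ suc))
  go (a ∷ p) (b ∷ r) e = cong₂ _+ℤ_ (e zero) (go p r (e ∘ suc))

eval₁-⊕ : ∀ p r → eval₁ (p ⊕ r) ≡ eval₁ p +ℤ eval₁ r
eval₁-⊕ []      r       = sym (ℤₚ.+-identityˡ _)
eval₁-⊕ (a ∷ p) []      = sym (ℤₚ.+-identityʳ _)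
eval₁-⊕ (a ∷ p) (b ∷ r) = trans (cong (a +ℤ b +ℤ_) (eval₁-⊕ p r)) (interchange a b (eval₁ p) (eval₁ r))
  where
  interchange : ∀ a b x y → a +ℤ b +ℤ (x +ℤ y) ≡ a +ℤ x +ℤ (b +ℤ y)
  interchange = ℤ-Solver.solve-∀

eval₁-scale : ∀ c p → eval₁ (scale c p) ≡ c *ℤ eval₁ p
eval₁-scale c []      = sym (ℤₚ.*-zeroʳ c)
eval₁-scale c (a ∷ p) = trans (cong (c *ℤ a +ℤ_) (eval₁-scale c p)) (sym (ℤₚ.*-distribˡ-+ c a (eval₁ p)))

eval₁-⊗ : ∀ p r → eval₁ (p ⊗ r) ≡ eval₁ p *ℤ eval₁ r
eval₁-⊗ []      r = sym (ℤₚ.*-zeroˡ (eval₁ r))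
eval₁-⊗ (a ∷ p) r = begin
  eval₁ (scale a r ⊕ (0ℤ ∷ p ⊗ r))
    ≡⟨ eval₁-⊕ (scale a r) (0ℤ ∷ p ⊗ r) ⟩
  eval₁ (scale a r) +ℤ (0ℤ +ℤ eval₁ (p ⊗ r))
    ≡⟨ cong₂ _+ℤ_ (eval₁-scale a r) (ℤₚ.+-identityˡ _) ⟩
  a *ℤ eval₁ r +ℤ eval₁ (p ⊗ r)              ≡⟨ cong (a *ℤ eval₁ r +ℤ_) (eval₁-⊗ p r) ⟩
  a *ℤ eval₁ r +ℤ eval₁ p *ℤ eval₁ r         ≡⟨ ℤₚ.*-distribʳ-+ (eval₁ r) a (eval₁ p) ⟨
  (a +ℤ eval₁ p) *ℤ eval₁ r                  ∎
  where open ≡-Reasoning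

eval₁-qpow : ∀ a → eval₁ (qpow a) ≡ 1ℤ
eval₁-qpow zero    = refl
eval₁-qpow (suc a) = trans (ℤₚ.+-identityˡ _) (eval₁-qpow a)

eval₁-qpow⊗ : ∀ a p → eval₁ (qpow a ⊗ p) ≡ eval₁ p
eval₁-qpow⊗ a p =
  trans (eval₁-⊗ (qpow a) p) (trans (cong (_*ℤ eval₁ p) (eval₁-qpow a)) (ℤₚ.*-identityˡ _))

eval₁-q⊗ : ∀ p → eval₁ (q ⊗ p) ≡ eval₁ p
eval₁-q⊗ = eval₁-qpow⊗ 1

eval₁≢0⇒nonZero : ∀ p → eval₁ p ≢ 0ℤ → NonZeroPoly p
eval₁≢0⇒nonZero []      ev≢0 = contradiction refl ev≢0
eval₁≢0⇒nonZero (c ∷ p) ev≢0 with c ℤ.≟ 0ℤ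
... | no  c≢0  = zero , c≢0
... | yes refl = let i , pᵢ≢0 = eval₁≢0⇒nonZero p (ev≢0 ∘ trans (ℤₚ.+-identityˡ _)) in suc i , pᵢ≢0

-- Induction on the binary expansion

data Parity : ℕ → Set where
  zero : Parity 0
  odd  : ∀ m → Parity (suc (2 * m))
  even : ∀ m → Parity (2 * suc m)

parity : ∀ n → Parity n
parity zero = zero
parity (suc n) with parity n
... | zero   = odd 0
... | odd m  = subst Parity (ℕₚ.*-suc 2 m) (even m)
... | even m = odd (suc m)

m<1+2m : ∀ m → m < suc (2 * m)
m<1+2m m = s≤s (ℕₚ.m≤m+n m _)

1+m<2[1+m] : ∀ m → suc m < 2 * suc m
1+m<2[1+m] m = ℕₚ.m<m+n (suc m) (s≤s z≤n)

binary-ind : ∀ {ℓ} (P : ℕ → Set ℓ) → P 0 → (∀ m → P m → P (suc (2 * m))) →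
             (∀ m → P (suc m) → P (2 * suc m)) → ∀ n → P n
binary-ind P P0 P-odd P-even = <-rec P step
  where
  step : ∀ n → (∀ {m} → m < n → P m) → P n
  step n rec with parity n
  ... | zero   = P0
  ... | odd m  = P-odd m (rec (m<1+2m m))
  ... | even m = P-even m (rec (1+m<2[1+m] m))

-- Stern's diatomic sequence

fuscF-fuel : ∀ {f f′} n → n ≤ f → n ≤ f′ → fuscF f n ≡ fuscF f′ n
fuscF-fuel {zero}  {zero}   zero                _         _          = refl
fuscF-fuel {zero}  {suc _}  zero                _         _          = refl
fuscF-fuel {suc _} {zero}   zero                _         _          = refl
fuscF-fuel {suc _} {suc _}  zero                _         _          = refl
fuscF-fuel {suc _} {suc _}  1                   _         _          = refl
fuscF-fuel {suc _} {suc _}  2                   (s≤s 1≤f) (s≤s 1≤f′) = fuscF-fuel 1 1≤f 1≤f′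
fuscF-fuel {suc _} {suc _}  (suc (suc (suc k))) (s≤s n≤f) (s≤s n≤f′) =
  cong₂ (λ x y → if suc k % 2 ≡ᵇ 0 then x else x + y)
    (fuscF-fuel (1 + h) (ℕₚ.≤-trans 1+h≤2+k n≤f) (ℕₚ.≤-trans 1+h≤2+k n≤f′))
    (fuscF-fuel (2 + h) (ℕₚ.≤-trans 2+h≤2+k n≤f) (ℕₚ.≤-trans 2+h≤2+k n≤f′))
  where
  h = suc k / 2
  1+h≤2+k : 1 + h ≤ 2 + k
  1+h≤2+k = s≤s (m/n≤m (suc k) 2)
  2+h≤2+k : 2 + h ≤ 2 + k
  2+h≤2+k = s≤s (m/n<m (suc k) 2 ℕₚ.≤-refl)

even%2 : ∀ m → (2 * m) % 2 ≡ 0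
even%2 m = trans (cong (_% 2) (ℕₚ.*-comm 2 m)) (m*n%n≡0 m 2)

even/2 : ∀ m → (2 * m) / 2 ≡ m
even/2 m = trans (cong (_/ 2) (ℕₚ.*-comm 2 m)) (m*n/n≡m m 2)

odd%2 : ∀ m → suc (2 * m) % 2 ≡ 1
odd%2 m = trans (cong (λ x → suc x % 2) (ℕₚ.*-comm 2 m)) ([m+kn]%n≡m%n 1 m 2)

odd/2 : ∀ m → suc (2 * m) / 2 ≡ m
odd/2 m = trans (+-distrib-/-∣ʳ 1 {d = 2} (m∣m*n m)) (even/2 m)

fusc-2m+2 : ∀ m → fusc (2 + 2 * m) ≡ fusc (suc m)
fusc-2m+2 m rewrite even%2 m | even/2 m = fuscF-fuel (suc m) (s≤s (ℕₚ.m≤m+n m _)) ℕₚ.≤-refl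

fusc-2m : ∀ m → fusc (2 * m) ≡ fusc m
fusc-2m zero    = refl
fusc-2m (suc m) = trans (cong fusc (ℕₚ.*-suc 2 m)) (fusc-2m+2 m)

fusc-2m+1 : ∀ m → fusc (suc (2 * m)) ≡ fusc m + fusc (suc m)
fusc-2m+1 zero    = refl
fusc-2m+1 (suc m) = trans (cong (fusc ∘ suc) (ℕₚ.*-suc 2 m)) unfold
  where
  unfold : fusc (3 + 2 * m) ≡ fusc (suc m) + fusc (2 + m)
  unfold rewrite odd%2 m | odd/2 m = cong₂ _+_
    (fuscF-fuel (suc m) (ℕₚ.m≤n⇒m≤1+n (s≤s (ℕₚ.m≤m+n m _))) ℕₚ.≤-refl)
    (fuscF-fuel (2 + m) (s≤s (s≤s (ℕₚ.m≤m+n m _))) ℕₚ.≤-refl)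

fusc-suc-pos : ∀ n → ∃[ b ] fusc (suc n) ≡ suc b
fusc-suc-pos = binary-ind _ (0 , refl) odd-step even-step
  where
  odd-step : ∀ m → ∃[ b ] fusc (suc m) ≡ suc b → ∃[ b ] fusc (2 + 2 * m) ≡ suc b
  odd-step m (b , eq) = b , trans (fusc-2m+2 m) eq
  even-step : ∀ m → ∃[ b ] fusc (2 + m) ≡ suc b → ∃[ b ] fusc (suc (2 * suc m)) ≡ suc b
  even-step m (b , eq) = fusc (suc m) + b ,
    trans (fusc-2m+1 (suc m)) (trans (cong (fusc (suc m) +_) eq) (ℕₚ.+-suc (fusc (suc m)) b))

-- Hyperbinary partitions

⨁ : {A : Set} → List A → (A → Poly) → Poly
⨁ xs f = foldr (λ x acc → f x ⊕ acc) [] xs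

⨁-++ : ∀ {A : Set} (xs ys : List A) f → ⨁ (xs ++ ys) f ≋ ⨁ xs f ⊕ ⨁ ys f
⨁-++ []       ys f = ≋-refl
⨁-++ (x ∷ xs) ys f = ≋-trans (⊕-cong ≋-refl (⨁-++ xs ys f)) (≋-sym (⊕-assoc (f x) _ _))

⨁-concatMap : ∀ {A B : Set} (g : A → List B) xs f → ⨁ (concatMap g xs) f ≋ ⨁ xs (λ x → ⨁ (g x) f)
⨁-concatMap g []       f = ≋-refl
⨁-concatMap g (x ∷ xs) f = ≋-trans (⨁-++ (g x) (concatMap g xs) f) (⊕-cong ≋-refl (⨁-concatMap g xs f))

⨁-cong : ∀ {A : Set} (xs : List A) {f g} → (∀ x → f x ≋ g x) → ⨁ xs f ≋ ⨁ xs g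
⨁-cong []       f≋g = ≋-refl
⨁-cong (x ∷ xs) f≋g = ⊕-cong (f≋g x) (⨁-cong xs f≋g)

⨁-⊕ : ∀ {A : Set} (xs : List A) f g → ⨁ xs (λ x → f x ⊕ g x) ≋ ⨁ xs f ⊕ ⨁ xs g
⨁-⊕ []       f g = ≋-refl
⨁-⊕ (x ∷ xs) f g = ≋-trans (⊕-cong ≋-refl (⨁-⊕ xs f g)) (⊕-interchange (f x) (g x) _ _)

⨁-⊗ : ∀ {A : Set} (xs : List A) c f → ⨁ xs (λ x → c ⊗ f x) ≋ c ⊗ ⨁ xs f
⨁-⊗ []       c f = ≋-sym (⊗-zeroʳ c)
⨁-⊗ (x ∷ xs) c f = ≋-trans (⊕-cong ≋-refl (⨁-⊗ xs c f)) (≋-sym (⊗-distribˡ c (f x) _))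

weight size : List ℕ → ℕ
weight v = sumL (toPartition v)
size   v = length (toPartition v)

sum-replicate : ∀ d x → sumL (replicate d x) ≡ d * x
sum-replicate zero    x = refl
sum-replicate (suc d) x = cong (x +_) (sum-replicate d x)

sum-partsFrom-suc : ∀ i v → sumL (partsFrom (suc i) v) ≡ 2 * sumL (partsFrom i v)
sum-partsFrom-suc i []      = refl
sum-partsFrom-suc i (d ∷ v) = begin
  sumL (replicate d (2 ^ suc i) ++ partsFrom (2 + i) v)
    ≡⟨ sum-++ (replicate d (2 ^ suc i)) _ ⟩
  sumL (replicate d (2 ^ suc i)) + sumL (partsFrom (2 + i) v)
    ≡⟨ cong₂ _+_ (sum-replicate d _) (sum-partsFrom-suc (suc i) v) ⟩
  d * (2 * 2 ^ i) + 2 * X                                      ≡⟨ factor d (2 ^ i) X ⟩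
  2 * (d * 2 ^ i + X)                                          ≡⟨ cong (2 *_) (cong (_+ X) (sum-replicate d _)) ⟨
  2 * (sumL (replicate d (2 ^ i)) + X)                         ≡⟨ cong (2 *_) (sum-++ (replicate d (2 ^ i)) _) ⟨
  2 * sumL (partsFrom i (d ∷ v))                               ∎
  where
  open ≡-Reasoning
  X = sumL (partsFrom (suc i) v)
  factor : ∀ d p x → d * (2 * p) + 2 * x ≡ 2 * (d * p + x)
  factor = ℕ-Solver.solve-∀

length-partsFrom-suc : ∀ i v → length (partsFrom (suc i) v) ≡ length (partsFrom i v)
length-partsFrom-suc i []      = refl
length-partsFrom-suc i (d ∷ v) = begin
  length (replicate d (2 ^ suc i) ++ partsFrom (2 + i) v)
    ≡⟨ Listₚ.length-++ (replicate d (2 ^ suc i)) ⟩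
  length (replicate d (2 ^ suc i)) + length (partsFrom (2 + i) v)
    ≡⟨ cong₂ _+_ (Listₚ.length-replicate d) (length-partsFrom-suc (suc i) v) ⟩
  d + length (partsFrom (suc i) v)
    ≡⟨ cong₂ _+_ (Listₚ.length-replicate d) refl ⟨
  length (replicate d (2 ^ i)) + length (partsFrom (suc i) v)
    ≡⟨ Listₚ.length-++ (replicate d (2 ^ i)) ⟨
  length (partsFrom i (d ∷ v))
    ∎
  where open ≡-Reasoning

weight-∷ : ∀ d v → weight (d ∷ v) ≡ d + 2 * weight v
weight-∷ d v = trans (sum-++ (replicate d 1) (partsFrom 1 v))
  (cong₂ _+_ (trans (sum-replicate d 1) (ℕₚ.*-identityʳ d)) (sum-partsFrom-suc 0 v))

size-∷ : ∀ d v → size (d ∷ v) ≡ d + size v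
size-∷ d v = trans (Listₚ.length-++ (replicate d 1))
  (cong₂ _+_ (Listₚ.length-replicate d) (length-partsFrom-suc 0 v))

hqTerm : ℕ → List ℕ → Poly
hqTerm n v = if does (weight v ℕ.≟ n) then qpow (size v) else []

hq-⨁ : ∀ n → hq n ≡ ⨁ (multVecs (suc n)) (hqTerm n)
hq-⨁ n = go (multVecs (suc n))
  where
  go : ∀ L → ⨁ (filter (λ η → sumL η ℕ.≟ n) (map toPartition L)) (qpow ∘ length) ≡ ⨁ L (hqTerm n)
  go []      = refl
  go (v ∷ L) with does (weight v ℕ.≟ n)
  ... | true  = cong (qpow (size v) ⊕_) (go L)
  ... | false = go L

hqTerm-≡ : ∀ {n} v → weight v ≡ n → hqTerm n v ≡ qpow (size v)
hqTerm-≡ {n} v eq = cong (if_then qpow (size v) else []) (dec-true (weight v ℕ.≟ n) eq)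

hqTerm-≢ : ∀ {n} v → weight v ≢ n → hqTerm n v ≡ []
hqTerm-≢ {n} v neq = cong (if_then qpow (size v) else []) (dec-false (weight v ℕ.≟ n) neq)

hqTerm-∷ : ∀ {n m} d v → n ≡ d + 2 * m → hqTerm n (d ∷ v) ≋ qpow d ⊗ hqTerm m v
hqTerm-∷ {n} {m} d v n≡ with weight v ℕ.≟ m
... | yes w≡m = begin
  hqTerm n (d ∷ v)         ≡⟨ hqTerm-≡ (d ∷ v) (trans (weight-∷ d v) (trans (cong (λ w → d + 2 * w) w≡m) (sym n≡))) ⟩
  qpow (size (d ∷ v))      ≡⟨ cong qpow (size-∷ d v) ⟩
  qpow (d + size v)        ≈⟨ qpow-+ d (size v) ⟩
  qpow d ⊗ qpow (size v)   ≡⟨ cong (qpow d ⊗_) (hqTerm-≡ v w≡m) ⟨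
  qpow d ⊗ hqTerm m v      ∎
  where open SetoidReasoning ≋-setoid
... | no w≢m = begin
  hqTerm n (d ∷ v)         ≡⟨ hqTerm-≢ (d ∷ v) (w≢m ∘ halve) ⟩
  []                       ≈⟨ ⊗-zeroʳ (qpow d) ⟨
  qpow d ⊗ []              ≡⟨ cong (qpow d ⊗_) (hqTerm-≢ v w≢m) ⟨
  qpow d ⊗ hqTerm m v      ∎
  where
  open SetoidReasoning ≋-setoid
  halve : weight (d ∷ v) ≡ n → weight v ≡ m
  halve eq = ℕₚ.*-cancelˡ-≡ (weight v) m 2
    (ℕₚ.+-cancelˡ-≡ d _ _ (trans (sym (weight-∷ d v)) (trans eq n≡)))

hqTerm-∷-≢ : ∀ {n} d v → (∀ w → d + 2 * w ≢ n) → hqTerm n (d ∷ v) ≡ []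
hqTerm-∷-≢ d v d+2w≢n = hqTerm-≢ (d ∷ v) (d+2w≢n (weight v) ∘ trans (sym (weight-∷ d v)))

-- The contribution to h_q(n) of the partitions into parts < 2^k (multiplicity vectors of length k).
hqBounded : ℕ → ℕ → Poly
hqBounded k n = ⨁ (multVecs k) (hqTerm n)

hqBounded-suc : ∀ k n → hqBounded (suc k) n ≋
  ⨁ (multVecs k) (λ v → hqTerm n (0 ∷ v) ⊕ (hqTerm n (1 ∷ v) ⊕ (hqTerm n (2 ∷ v) ⊕ [])))
hqBounded-suc k n = ⨁-concatMap _ (multVecs k) (hqTerm n)

hqBounded-0 : ∀ k → hqBounded k 0 ≋ one
hqBounded-0 zero    = ⊕-identityʳ one
hqBounded-0 (suc k) = ≋-trans (hqBounded-suc k 0) (≋-trans (⨁-cong (multVecs k) digits) (hqBounded-0 k))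
  where
  digits : ∀ v → hqTerm 0 (0 ∷ v) ⊕ (hqTerm 0 (1 ∷ v) ⊕ (hqTerm 0 (2 ∷ v) ⊕ [])) ≋ hqTerm 0 v
  digits v = begin
    hqTerm 0 (0 ∷ v) ⊕ (hqTerm 0 (1 ∷ v) ⊕ (hqTerm 0 (2 ∷ v) ⊕ []))
      ≡⟨ cong₂ (λ x y → hqTerm 0 (0 ∷ v) ⊕ (x ⊕ (y ⊕ [])))
           (hqTerm-∷-≢ {0} 1 v λ _ ()) (hqTerm-∷-≢ {0} 2 v λ _ ()) ⟩
    hqTerm 0 (0 ∷ v) ⊕ []   ≈⟨ ⊕-identityʳ _ ⟩
    hqTerm 0 (0 ∷ v)        ≈⟨ hqTerm-∷ 0 v refl ⟩
    one ⊗ hqTerm 0 v        ≈⟨ ⊗-identityˡ _ ⟩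
    hqTerm 0 v              ∎
    where open SetoidReasoning ≋-setoid

hqBounded-2m+1 : ∀ k m → hqBounded (suc k) (suc (2 * m)) ≋ q ⊗ hqBounded k m
hqBounded-2m+1 k m = ≋-trans (hqBounded-suc k n)
  (≋-trans (⨁-cong (multVecs k) digits) (⨁-⊗ (multVecs k) q (hqTerm m)))
  where
  n = suc (2 * m)
  digits : ∀ v → hqTerm n (0 ∷ v) ⊕ (hqTerm n (1 ∷ v) ⊕ (hqTerm n (2 ∷ v) ⊕ [])) ≋ q ⊗ hqTerm m v
  digits v = begin
    hqTerm n (0 ∷ v) ⊕ (hqTerm n (1 ∷ v) ⊕ (hqTerm n (2 ∷ v) ⊕ []))
      ≡⟨ cong₂ (λ x y → x ⊕ (hqTerm n (1 ∷ v) ⊕ (y ⊕ [])))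
           (hqTerm-∷-≢ 0 v λ w → ℕₚ.even≢odd w m)
           (hqTerm-∷-≢ 2 v λ w → ℕₚ.even≢odd m w ∘ sym ∘ ℕₚ.suc-injective) ⟩
    hqTerm n (1 ∷ v) ⊕ []   ≈⟨ ⊕-identityʳ _ ⟩
    hqTerm n (1 ∷ v)        ≈⟨ hqTerm-∷ 1 v refl ⟩
    q ⊗ hqTerm m v          ∎
    where open SetoidReasoning ≋-setoid

hqBounded-2m+2 : ∀ k m → hqBounded (suc k) (2 * suc m) ≋ hqBounded k (suc m) ⊕ ((q ⊗ q) ⊗ hqBounded k m)
hqBounded-2m+2 k m = ≋-trans (hqBounded-suc k n) (≋-trans (⨁-cong (multVecs k) digits)
  (≋-trans (⨁-⊕ (multVecs k) _ _) (⊕-cong ≋-refl (⨁-⊗ (multVecs k) (q ⊗ q) (hqTerm m)))))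
  where
  n = 2 * suc m
  digits : ∀ v → hqTerm n (0 ∷ v) ⊕ (hqTerm n (1 ∷ v) ⊕ (hqTerm n (2 ∷ v) ⊕ [])) ≋
                 hqTerm (suc m) v ⊕ ((q ⊗ q) ⊗ hqTerm m v)
  digits v = begin
    hqTerm n (0 ∷ v) ⊕ (hqTerm n (1 ∷ v) ⊕ (hqTerm n (2 ∷ v) ⊕ []))
      ≡⟨ cong (λ x → hqTerm n (0 ∷ v) ⊕ (x ⊕ (hqTerm n (2 ∷ v) ⊕ [])))
           (hqTerm-∷-≢ 1 v λ w → ℕₚ.even≢odd (suc m) w ∘ sym) ⟩
    hqTerm n (0 ∷ v) ⊕ (hqTerm n (2 ∷ v) ⊕ [])
      ≈⟨ ⊕-cong (hqTerm-∷ 0 v refl) (≋-trans (⊕-identityʳ _) (hqTerm-∷ 2 v (ℕₚ.*-suc 2 m))) ⟩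
    (one ⊗ hqTerm (suc m) v) ⊕ (qpow 2 ⊗ hqTerm m v)
      ≈⟨ ⊕-cong (⊗-identityˡ (hqTerm (suc m) v)) (⊗-congˡ (hqTerm m v) (qpow-+ 1 1)) ⟩
    hqTerm (suc m) v ⊕ ((q ⊗ q) ⊗ hqTerm m v) ∎
    where open SetoidReasoning ≋-setoid

hqBounded-stable : ∀ {k k′} n → n < k → n < k′ → hqBounded k n ≋ hqBounded k′ n
hqBounded-stable {suc k} {suc k′} n (s≤s n≤k) (s≤s n≤k′) with parity n
... | zero   = ≋-trans (hqBounded-0 (suc k)) (≋-sym (hqBounded-0 (suc k′)))
... | odd m  = ≋-trans (hqBounded-2m+1 k m) (≋-trans
  (⊗-congʳ q (hqBounded-stable m (ℕₚ.<-≤-trans (m<1+2m m) n≤k) (ℕₚ.<-≤-trans (m<1+2m m) n≤k′)))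
  (≋-sym (hqBounded-2m+1 k′ m)))
... | even m = ≋-trans (hqBounded-2m+2 k m) (≋-trans
  (⊕-cong (hqBounded-stable (suc m) (1+m<k n≤k) (1+m<k n≤k′))
          (⊗-congʳ (q ⊗ q) (hqBounded-stable m (m<k n≤k) (m<k n≤k′))))
  (≋-sym (hqBounded-2m+2 k′ m)))
  where
  1+m<k : ∀ {j} → 2 * suc m ≤ j → suc m < j
  1+m<k = ℕₚ.<-≤-trans (1+m<2[1+m] m)
  m<k : ∀ {j} → 2 * suc m ≤ j → m < j
  m<k = ℕₚ.<-trans (ℕₚ.n<1+n m) ∘ 1+m<k

hq≋hqBounded : ∀ {k} n → n < k → hq n ≋ hqBounded k n
hq≋hqBounded n n<k = ≋-trans (≋-reflexive (hq-⨁ n)) (hqBounded-stable n ℕₚ.≤-refl n<k)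

-- qfusc n = h_q(n − 1), so that CW_q(n) = qfusc n / qfusc (n + 1); at q = 1 it is fusc n.
qfusc : ℕ → Poly
qfusc zero    = []
qfusc (suc n) = hq n

qfusc-2m+2 : ∀ m → qfusc (2 + 2 * m) ≋ q ⊗ qfusc (suc m)
qfusc-2m+2 m = begin
  hq (suc (2 * m))                     ≈⟨ hq≋hqBounded (suc (2 * m)) ℕₚ.≤-refl ⟩
  hqBounded (2 + 2 * m) (suc (2 * m))  ≈⟨ hqBounded-2m+1 (suc (2 * m)) m ⟩
  q ⊗ hqBounded (suc (2 * m)) m        ≈⟨ ⊗-congʳ q (hq≋hqBounded m (m<1+2m m)) ⟨
  q ⊗ hq m                             ∎
  where open SetoidReasoning ≋-setoid

qfusc-2m : ∀ m → qfusc (2 * m) ≋ q ⊗ qfusc m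
qfusc-2m zero    = ≋-sym (⊗-zeroʳ q)
qfusc-2m (suc m) = ≋-trans (≋-reflexive (cong qfusc (ℕₚ.*-suc 2 m))) (qfusc-2m+2 m)

qfusc-2m+1 : ∀ m → qfusc (suc (2 * m)) ≋ qfusc (suc m) ⊕ (q ⊗ (q ⊗ qfusc m))
qfusc-2m+1 zero    = ≋-sym (≋-trans (⊕-cong {hq 0} ≋-refl q²⊗[]≋[]) (⊕-identityʳ (hq 0)))
  where
  q²⊗[]≋[] : q ⊗ (q ⊗ []) ≋ []
  q²⊗[]≋[] = ≋-trans (⊗-congʳ q (⊗-zeroʳ q)) (⊗-zeroʳ q)
qfusc-2m+1 (suc m) = begin
  hq (2 * suc m)
    ≈⟨ hq≋hqBounded (2 * suc m) ℕₚ.≤-refl ⟩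
  hqBounded (suc (2 * suc m)) (2 * suc m)
    ≈⟨ hqBounded-2m+2 (2 * suc m) m ⟩
  hqBounded (2 * suc m) (suc m) ⊕ ((q ⊗ q) ⊗ hqBounded (2 * suc m) m)
    ≈⟨ ⊕-cong (hq≋hqBounded (suc m) (1+m<2[1+m] m)) (⊗-congʳ (q ⊗ q) (hq≋hqBounded m m<2[1+m])) ⟨
  hq (suc m) ⊕ ((q ⊗ q) ⊗ hq m)
    ≈⟨ ⊕-cong {hq (suc m)} ≋-refl (⊗-assoc q q (hq m)) ⟩
  hq (suc m) ⊕ (q ⊗ (q ⊗ hq m))
    ∎
  where
  open SetoidReasoning ≋-setoid
  m<2[1+m] = ℕₚ.<-trans (ℕₚ.n<1+n m) (1+m<2[1+m] m)

eval₁-2m : ∀ {m} p → eval₁ p ≡ ℤ.+ fusc m → eval₁ (q ⊗ p) ≡ ℤ.+ fusc (2 * m)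
eval₁-2m {m} p eq = trans (eval₁-q⊗ p) (trans eq (cong ℤ.+_ (sym (fusc-2m m))))

eval₁-2m+1 : ∀ {m} p r → eval₁ p ≡ ℤ.+ fusc m → eval₁ r ≡ ℤ.+ fusc (suc m) →
             eval₁ (r ⊕ (q ⊗ p)) ≡ ℤ.+ fusc (suc (2 * m))
eval₁-2m+1 {m} p r eq-p eq-r = begin
  eval₁ (r ⊕ (q ⊗ p))          ≡⟨ eval₁-⊕ r (q ⊗ p) ⟩
  eval₁ r +ℤ eval₁ (q ⊗ p)      ≡⟨ cong₂ _+ℤ_ eq-r (trans (eval₁-q⊗ p) eq-p) ⟩
  ℤ.+ (fusc (suc m) + fusc m)   ≡⟨ cong ℤ.+_ (ℕₚ.+-comm (fusc (suc m)) (fusc m)) ⟩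
  ℤ.+ (fusc m + fusc (suc m))   ≡⟨ cong ℤ.+_ (fusc-2m+1 m) ⟨
  ℤ.+ fusc (suc (2 * m))        ∎
  where open ≡-Reasoning

eval₁-qfusc : ∀ n → eval₁ (qfusc n) ≡ ℤ.+ fusc n × eval₁ (qfusc (suc n)) ≡ ℤ.+ fusc (suc n)
eval₁-qfusc = binary-ind (λ n → Agrees n × Agrees (suc n)) (refl , refl) odd-step even-step
  where
  Agrees : ℕ → Set
  Agrees n = eval₁ (qfusc n) ≡ ℤ.+ fusc n
  odd-step : ∀ m → Agrees m × Agrees (suc m) → Agrees (suc (2 * m)) × Agrees (2 + 2 * m)
  odd-step m (e₀ , e₁) =
    trans (eval₁-cong (qfusc-2m+1 m))
          (eval₁-2m+1 {m} (q ⊗ qfusc m) (qfusc (suc m)) (trans (eval₁-q⊗ (qfusc m)) e₀) e₁) ,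
    trans (eval₁-cong (qfusc-2m+2 m))
          (trans (eval₁-q⊗ (qfusc (suc m))) (trans e₁ (cong ℤ.+_ (sym (fusc-2m+2 m)))))
  even-step : ∀ m → Agrees (suc m) × Agrees (2 + m) → Agrees (2 * suc m) × Agrees (suc (2 * suc m))
  even-step m (e₁ , e₂) =
    trans (eval₁-cong (qfusc-2m (suc m))) (eval₁-2m {suc m} (qfusc (suc m)) e₁) ,
    trans (eval₁-cong (qfusc-2m+1 (suc m)))
          (eval₁-2m+1 {suc m} (q ⊗ qfusc (suc m)) (qfusc (2 + m)) (trans (eval₁-q⊗ (qfusc (suc m))) e₁) e₂)

-- Continued fractions

cfExp-fuel : ∀ {f f′} a b → b < f → b < f′ → cfExp f a b ≡ cfExp f′ a b
cfExp-fuel {suc f} {suc f′} a zero    _         _          = refl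
cfExp-fuel {suc f} {suc f′} a (suc b) (s≤s b<f) (s≤s b<f′) = cong (a / suc b ∷_)
  (cfExp-fuel (suc b) (a % suc b) (ℕₚ.<-≤-trans (m%n<n a (suc b)) b<f) (ℕₚ.<-≤-trans (m%n<n a (suc b)) b<f′))

sucHead : List ℕ → List ℕ
sucHead []      = []
sucHead (a ∷ l) = suc a ∷ l

cfOf-+ : ∀ a b → cfOf (a + suc b) (suc b) ≡ sucHead (cfOf a (suc b))
cfOf-+ a b = cong₂ _∷_
  (trans (m/n≡1+[m∸n]/n (ℕₚ.m≤n+m (suc b) a)) (cong (λ x → suc (x / suc b)) (ℕₚ.m+n∸n≡m a (suc b))))
  (cong (cfExp (suc b) (suc b)) ([m+n]%n≡m%n a (suc b)))

cfOf-< : ∀ a b → a < suc b → cfOf a (suc b) ≡ 0 ∷ cfOf (suc b) a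
cfOf-< a b a<1+b = cong₂ _∷_ (m<n⇒m/n≡0 a<1+b)
  (trans (cong (cfExp (suc b) (suc b)) (m<n⇒m%n≡m a<1+b)) (cfExp-fuel (suc b) a a<1+b (ℕₚ.n<1+n a)))

cfOf-self : ∀ a → cfOf (suc a) (suc a) ≡ 1 ∷ []
cfOf-self a = cong₂ _∷_ (n/n≡1 (suc a)) (cong (cfExp (suc a) (suc a)) (n%n≡0 (suc a)))

cfOf-left : ∀ a b → cfOf (suc a) (suc a + suc b) ≡ 0 ∷ sucHead (cfOf (suc b) (suc a))
cfOf-left a b = begin
  cfOf (suc a) (suc a + suc b)            ≡⟨ cfOf-< (suc a) (a + suc b) (s≤s (ℕₚ.m<m+n a (s≤s z≤n))) ⟩
  0 ∷ cfOf (suc a + suc b) (suc a)        ≡⟨ cong (λ x → 0 ∷ cfOf x (suc a)) (ℕₚ.+-comm (suc a) (suc b)) ⟩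
  0 ∷ cfOf (suc b + suc a) (suc a)        ≡⟨ cong (0 ∷_) (cfOf-+ (suc b) a) ⟩
  0 ∷ sucHead (cfOf (suc b) (suc a))      ∎
  where open ≡-Reasoning

-- cfq leaves common powers of q in numerator and denominator; this relation forgets them.
_∝_ : RatFun → RatFun → Set
r ∝ s = ∃[ e ] num r ≋ qpow e ⊗ num s × den r ≋ qpow e ⊗ den s

≋⇒∝ : ∀ {r s} → num r ≋ num s → den r ≋ den s → r ∝ s
≋⇒∝ num≋ den≋ = 0 , ≋-trans num≋ (≋-sym (⊗-identityˡ _)) , ≋-trans den≋ (≋-sym (⊗-identityˡ _))

∝-refl : ∀ {r} → r ∝ r
∝-refl = ≋⇒∝ ≋-refl ≋-refl

qRight qLeft : RatFun → RatFun
qRight (N // D) = (D ⊕ (q ⊗ N)) // D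
qLeft  (N // D) = (q ⊗ N) // (D ⊕ (q ⊗ N))

cfq-sucHead : ∀ a l → cfq true (suc a ∷ l) ∝ qRight (cfq true (a ∷ l))
cfq-sucHead a []      = ≋⇒∝ (qint-suc a) ≋-refl
cfq-sucHead a (b ∷ l) = ≋⇒∝ (≋-trans num≋ (expand (qint a) (qpow a) X Y)) ≋-refl
  where
  X = num (cfq false (b ∷ l))
  Y = den (cfq false (b ∷ l))
  num≋ : (qint (suc a) ⊗ (one ⊗ X)) ⊕ ((qpow (suc a) ⊗ Y) ⊗ one) ≋
         ((one ⊕ (q ⊗ qint a)) ⊗ (one ⊗ X)) ⊕ (((q ⊗ qpow a) ⊗ Y) ⊗ one)
  num≋ = ⊕-cong (⊗-congˡ (one ⊗ X) (qint-suc a)) (⊗-congˡ one (⊗-congˡ Y (qpow-suc a)))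
  expand : ∀ I P X Y → ((one ⊕ (q ⊗ I)) ⊗ (one ⊗ X)) ⊕ (((q ⊗ P) ⊗ Y) ⊗ one) ≋
                       (one ⊗ (one ⊗ X)) ⊕ (q ⊗ ((I ⊗ (one ⊗ X)) ⊕ ((P ⊗ Y) ⊗ one)))
  expand = RingSolver.solve-∀ polyRing

cfq-0∷sucHead : ∀ a l → cfq true (0 ∷ suc a ∷ l) ∝ qLeft (cfq true (0 ∷ a ∷ l))
cfq-0∷sucHead a [] = ≋⇒∝
  (≋-trans (⊗-congˡ one (⊗-congʳ one (qpow-suc a))) (num-id (qpow a)))
  (≋-trans (⊗-congʳ one (⊗-congʳ one (0∷qint-suc a))) (≋-trans (den-id (qint a) (qpow a))
           (⊕-cong (⊗-congʳ one (⊗-congʳ one (≋-sym (0∷≋q⊗ (qint a))))) ≋-refl)))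
  where
  num-id : ∀ P → (one ⊗ (q ⊗ P)) ⊗ one ≋ q ⊗ ((one ⊗ P) ⊗ one)
  num-id = RingSolver.solve-∀ polyRing
  den-id : ∀ I P → one ⊗ (one ⊗ (q ⊗ (I ⊕ P))) ≋ (one ⊗ (one ⊗ (q ⊗ I))) ⊕ (q ⊗ ((one ⊗ P) ⊗ one))
  den-id = RingSolver.solve-∀ polyRing
cfq-0∷sucHead a (b ∷ l) = 1 ,
  ≋-trans (⊗-congˡ one (⊗-congʳ one Y≋)) (num-id (qpow a) N) ,
  ≋-trans (⊗-congʳ one (⊗-congʳ one X≋))
    (≋-trans (den-id (qint a) (qpow a) N D)
             (⊗-congʳ q (⊕-cong (⊗-congʳ one (⊗-congʳ one (≋-sym X₀≋))) ≋-refl)))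
  where
  N = num (cfq true (b ∷ l))
  D = den (cfq true (b ∷ l))
  X≋ : ((0ℤ ∷ qint (suc a)) ⊗ (qpow (suc a) ⊗ N)) ⊕ ((one ⊗ D) ⊗ qpow (suc a)) ≋
       ((q ⊗ (qint a ⊕ qpow a)) ⊗ ((q ⊗ qpow a) ⊗ N)) ⊕ ((one ⊗ D) ⊗ (q ⊗ qpow a))
  X≋ = ⊕-cong (⊗-cong (0∷qint-suc a) (⊗-congˡ N (qpow-suc a))) (⊗-congʳ (one ⊗ D) (qpow-suc a))
  Y≋ : qpow (suc a) ⊗ (qpow (suc a) ⊗ N) ≋ (q ⊗ qpow a) ⊗ ((q ⊗ qpow a) ⊗ N)
  Y≋ = ⊗-cong (qpow-suc a) (⊗-congˡ N (qpow-suc a))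
  X₀≋ : ((0ℤ ∷ qint a) ⊗ (qpow a ⊗ N)) ⊕ ((one ⊗ D) ⊗ qpow a) ≋
        ((q ⊗ qint a) ⊗ (qpow a ⊗ N)) ⊕ ((one ⊗ D) ⊗ qpow a)
  X₀≋ = ⊕-cong (⊗-congˡ (qpow a ⊗ N) (0∷≋q⊗ (qint a))) ≋-refl
  num-id : ∀ P N → (one ⊗ ((q ⊗ P) ⊗ ((q ⊗ P) ⊗ N))) ⊗ one ≋
                  q ⊗ (q ⊗ ((one ⊗ (P ⊗ (P ⊗ N))) ⊗ one))
  num-id = RingSolver.solve-∀ polyRing
  den-id : ∀ I P N D →
    one ⊗ (one ⊗ (((q ⊗ (I ⊕ P)) ⊗ ((q ⊗ P) ⊗ N)) ⊕ ((one ⊗ D) ⊗ (q ⊗ P)))) ≋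
    q ⊗ ((one ⊗ (one ⊗ (((q ⊗ I) ⊗ (P ⊗ N)) ⊕ ((one ⊗ D) ⊗ P)))) ⊕ (q ⊗ ((one ⊗ (P ⊗ (P ⊗ N))) ⊗ one)))
  den-id = RingSolver.solve-∀ polyRing

cfq-0∷0∷ : ∀ a l → cfq true (0 ∷ 0 ∷ a ∷ l) ∝ cfq true (a ∷ l)
cfq-0∷0∷ a l = ≋⇒∝ (num-id N)
  (≋-trans (⊗-congʳ one (⊗-congʳ one (⊕-cong (⊗-congˡ (one ⊗ N) 0∷[]≋[]) ≋-refl))) (den-id D))
  where
  N = num (cfq true (a ∷ l))
  D = den (cfq true (a ∷ l))
  num-id : ∀ N → (one ⊗ (one ⊗ (one ⊗ N))) ⊗ one ≋ N
  num-id = RingSolver.solve-∀ polyRing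
  den-id : ∀ D → one ⊗ (one ⊗ ((one ⊗ D) ⊗ one)) ≋ D
  den-id = RingSolver.solve-∀ polyRing

cfq-0∷1 : cfq true (0 ∷ 1 ∷ []) ∝ cfq true (1 ∷ [])
cfq-0∷1 = 1 , mk≋ coefficients , mk≋ coefficients
  where
  coefficients : (0ℤ ∷ 1ℤ ∷ []) ≈ₚ (q ⊗ one)
  coefficients = λ { 0 → refl ; 1 → refl ; (suc (suc i)) → refl }

-- If a < b, then 0 ∷ cfOf b a is the expansion cfOf a b itself; otherwise the two expansions of a / b
-- differ by [0; 0, x] = [x] or [0; 1] = [1].
cfq-swap : ∀ a b → cfq true (0 ∷ cfOf (suc b) (suc a)) ∝ cfq true (cfOf (suc a) (suc b))
cfq-swap a b with ℕₚ.<-cmp (suc a) (suc b)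
... | tri< a<b _ _    rewrite cfOf-< (suc a) b a<b = ∝-refl
... | tri≈ _ refl _   rewrite cfOf-self a = cfq-0∷1
... | tri> _ _ b<a    rewrite cfOf-< (suc b) a b<a = cfq-0∷0∷ (suc a / suc b) (cfExp (suc b) (suc b) (suc a % suc b))

-- Following the Calkin–Wilf tree

record Tracks (n : ℕ) (r : RatFun) : Set where
  field
    cross    : num r ⊗ qfusc (suc n) ≋ (q ⊗ qfusc n) ⊗ den r
    eval-num : eval₁ (num r) ≡ ℤ.+ fusc n
    eval-den : eval₁ (den r) ≡ ℤ.+ fusc (suc n)
open Tracks

Tracks-∝ : ∀ {n r s} → r ∝ s → Tracks n s → Tracks n r
Tracks-∝ {n} {r} {s} (e , num≋ , den≋) t = record
  { cross = begin
      num r ⊗ qfusc (suc n)               ≈⟨ ⊗-congˡ (qfusc (suc n)) num≋ ⟩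
      (qpow e ⊗ num s) ⊗ qfusc (suc n)    ≈⟨ ⊗-assoc (qpow e) (num s) (qfusc (suc n)) ⟩
      qpow e ⊗ (num s ⊗ qfusc (suc n))    ≈⟨ ⊗-congʳ (qpow e) (cross t) ⟩
      qpow e ⊗ ((q ⊗ qfusc n) ⊗ den s)    ≈⟨ ⊗-leftComm (qpow e) (q ⊗ qfusc n) (den s) ⟩
      (q ⊗ qfusc n) ⊗ (qpow e ⊗ den s)    ≈⟨ ⊗-congʳ (q ⊗ qfusc n) den≋ ⟨
      (q ⊗ qfusc n) ⊗ den r               ∎
  ; eval-num = trans (eval₁-cong num≋) (trans (eval₁-qpow⊗ e (num s)) (eval-num t))
  ; eval-den = trans (eval₁-cong den≋) (trans (eval₁-qpow⊗ e (den s)) (eval-den t))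
  }
  where open SetoidReasoning ≋-setoid

Tracks-right : ∀ {m r} → Tracks m r → Tracks (suc (2 * m)) (qRight r)
Tracks-right {m} {N // D} t = record
  { cross = begin
      (D ⊕ (q ⊗ N)) ⊗ qfusc (2 + 2 * m)                ≈⟨ ⊗-congʳ (D ⊕ (q ⊗ N)) (qfusc-2m+2 m) ⟩
      (D ⊕ (q ⊗ N)) ⊗ (q ⊗ s₁)                         ≈⟨ expand D N s₁ ⟩
      (q ⊗ (D ⊗ s₁)) ⊕ ((q ⊗ q) ⊗ (N ⊗ s₁))            ≈⟨ ⊕-cong {q ⊗ (D ⊗ s₁)} ≋-refl (⊗-congʳ (q ⊗ q) (cross t)) ⟩
      (q ⊗ (D ⊗ s₁)) ⊕ ((q ⊗ q) ⊗ ((q ⊗ s₀) ⊗ D))      ≈⟨ collect D s₀ s₁ ⟩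
      (q ⊗ (s₁ ⊕ (q ⊗ (q ⊗ s₀)))) ⊗ D                  ≈⟨ ⊗-congˡ D (⊗-congʳ q (qfusc-2m+1 m)) ⟨
      (q ⊗ qfusc (suc (2 * m))) ⊗ D                    ∎
  ; eval-num = eval₁-2m+1 {m} N D (eval-num t) (eval-den t)
  ; eval-den = trans (eval-den t) (cong ℤ.+_ (sym (fusc-2m+2 m)))
  }
  where
  open SetoidReasoning ≋-setoid
  s₀ = qfusc m
  s₁ = qfusc (suc m)
  expand : ∀ D N s₁ → (D ⊕ (q ⊗ N)) ⊗ (q ⊗ s₁) ≋ (q ⊗ (D ⊗ s₁)) ⊕ ((q ⊗ q) ⊗ (N ⊗ s₁))
  expand = RingSolver.solve-∀ polyRing
  collect : ∀ D s₀ s₁ → (q ⊗ (D ⊗ s₁)) ⊕ ((q ⊗ q) ⊗ ((q ⊗ s₀) ⊗ D)) ≋ (q ⊗ (s₁ ⊕ (q ⊗ (q ⊗ s₀)))) ⊗ D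
  collect = RingSolver.solve-∀ polyRing

Tracks-left : ∀ {m r} → Tracks m r → Tracks (2 * m) (qLeft r)
Tracks-left {m} {N // D} t = record
  { cross = begin
      (q ⊗ N) ⊗ qfusc (suc (2 * m))                    ≈⟨ ⊗-congʳ (q ⊗ N) (qfusc-2m+1 m) ⟩
      (q ⊗ N) ⊗ (s₁ ⊕ (q ⊗ (q ⊗ s₀)))                  ≈⟨ expand N s₀ s₁ ⟩
      (q ⊗ (N ⊗ s₁)) ⊕ ((q ⊗ (q ⊗ q)) ⊗ (N ⊗ s₀))      ≈⟨ ⊕-cong (⊗-congʳ q (cross t)) ≋-refl ⟩
      (q ⊗ ((q ⊗ s₀) ⊗ D)) ⊕ ((q ⊗ (q ⊗ q)) ⊗ (N ⊗ s₀)) ≈⟨ collect N D s₀ ⟩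
      (q ⊗ (q ⊗ s₀)) ⊗ (D ⊕ (q ⊗ N))                   ≈⟨ ⊗-congˡ (D ⊕ (q ⊗ N)) (⊗-congʳ q (qfusc-2m m)) ⟨
      (q ⊗ qfusc (2 * m)) ⊗ (D ⊕ (q ⊗ N))              ∎
  ; eval-num = eval₁-2m {m} N (eval-num t)
  ; eval-den = eval₁-2m+1 {m} N D (eval-num t) (eval-den t)
  }
  where
  open SetoidReasoning ≋-setoid
  s₀ = qfusc m
  s₁ = qfusc (suc m)
  expand : ∀ N s₀ s₁ → (q ⊗ N) ⊗ (s₁ ⊕ (q ⊗ (q ⊗ s₀))) ≋ (q ⊗ (N ⊗ s₁)) ⊕ ((q ⊗ (q ⊗ q)) ⊗ (N ⊗ s₀))
  expand = RingSolver.solve-∀ polyRing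
  collect : ∀ N D s₀ → (q ⊗ ((q ⊗ s₀) ⊗ D)) ⊕ ((q ⊗ (q ⊗ q)) ⊗ (N ⊗ s₀)) ≋ (q ⊗ (q ⊗ s₀)) ⊗ (D ⊕ (q ⊗ N))
  collect = RingSolver.solve-∀ polyRing

Tracks-cfOf-right : ∀ {m} a b → Tracks m (cfq true (cfOf a (suc b))) →
                    Tracks (suc (2 * m)) (cfq true (cfOf (a + suc b) (suc b)))
Tracks-cfOf-right {m} a b t = subst (Tracks (suc (2 * m)) ∘ cfq true) (sym (cfOf-+ a b))
  (Tracks-∝ (cfq-sucHead (a / suc b) (cfExp (suc b) (suc b) (a % suc b))) (Tracks-right t))

Tracks-cfOf-left : ∀ {m} a b → Tracks m (cfq true (cfOf (suc a) (suc b))) →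
                   Tracks (2 * m) (cfq true (cfOf (suc a) (suc a + suc b)))
Tracks-cfOf-left {m} a b t = subst (Tracks (2 * m) ∘ cfq true) (sym (cfOf-left a b))
  (Tracks-∝ (cfq-0∷sucHead (suc b / suc a) (cfExp (suc a) (suc a) (suc b % suc a)))
    (Tracks-left (Tracks-∝ (cfq-swap a b) t)))

qCW-tracks : ∀ n → Tracks n (qCW n)
qCW-tracks = binary-ind _ base odd-step even-step
  where
  base : Tracks 0 (qCW 0)
  base = record
    { cross = ≋-sym (≋-trans (⊗-identityʳ (q ⊗ [])) (⊗-zeroʳ q)) ; eval-num = refl ; eval-den = refl }
  odd-step : ∀ m → Tracks m (qCW m) →
             Tracks (suc (2 * m)) (cfq true (cfOf (fusc (suc (2 * m))) (fusc (2 + 2 * m))))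
  odd-step m t rewrite fusc-2m+1 m | fusc-2m+2 m with fusc (suc m) | fusc-suc-pos m
  ... | _ | b , refl = Tracks-cfOf-right (fusc m) b t
  even-step : ∀ m → Tracks (suc m) (qCW (suc m)) →
              Tracks (2 * suc m) (cfq true (cfOf (fusc (2 * suc m)) (fusc (suc (2 * suc m)))))
  even-step m t rewrite fusc-2m (suc m) | fusc-2m+1 (suc m)
    with fusc (suc m) | fusc-suc-pos m | fusc (2 + m) | fusc-suc-pos (suc m)
  ... | _ | a , refl | _ | b , refl = Tracks-cfOf-left a b t

nonZero-fusc : ∀ {n} p → eval₁ p ≡ ℤ.+ fusc (suc n) → NonZeroPoly p
nonZero-fusc {n} p eq with fusc-suc-pos n
... | b , fb = eval₁≢0⇒nonZero p λ ev≡0 →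
  ℕₚ.0≢1+n (trans (sym (ℤₚ.+-injective (trans (sym eq) ev≡0))) fb)

CWq-qfusc : ∀ n → CWq n ≡ qfusc n // qfusc (suc n)
CWq-qfusc zero    = refl
CWq-qfusc (suc n) = refl

theorem2p3 : (n : ℕ) →
    NonZeroPoly (den (qCW n)) × NonZeroPoly (den (qTimes (CWq n))) × (qCW n ≈ᵣ qTimes (CWq n))
theorem2p3 n rewrite CWq-qfusc n =
  nonZero-fusc {n} (den (qCW n)) (eval-den t) ,
  nonZero-fusc {n} (qfusc (suc n)) (proj₂ (eval₁-qfusc n)) ,
  coeff-≡ (≋-trans (cross t) (⊗-congˡ (den (qCW n)) (≋-sym (0∷≋q⊗ (qfusc n)))))
  where t = qCW-tracks n
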